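{- Let $G$ be a finite simple graph. Then $\iota(\mathrm{Mid}(G)) = \nu'(G)$, where $\nu'(G)$ is the minimum value of $|M|$ over all maximal matchings $M$ of $G$.
   Context: For a graph $H$ and $S\subseteq V(H)$, let $N_H[S]=S\cup\{u: u \text{ adjacent to some vertex of } S\}$. A set $S\subseteq V(H)$ is an isolating set of $H$ if $V(H)\setminus N_H[S]$ is an independent set of $H$; the isolation number $\iota(H)$ is the minimum size of an isolating set of $H$. The middle graph $\mathrm{Mid}(G)$ of $G$ is the graph obtained from $G$ by subdividing each edge of $G$ exactly once and then joining by an edge each pair of subdivision vertices whose corresponding edges of $G$ share an endpoint; i.e. $V(\mathrm{Mid}(G))=V(G)\cup\{m_e: e\in E(G)\}$, $v\sim m_e$ iff $v$ is an endpoint of $e$, $m_e\sim m_f$ iff $e\ne f$ share an endpoint, and no two vertices of $V(G)$ are adjacent. A maximal matching is a matching not properly contained in another matching. -}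

module Defs where

open import Data.Nat using (ℕ; _≤_)
open import Data.Fin using (Fin; _<_)
open import Data.Bool using (Bool; true; false)
open import Data.Sum using (_⊎_; inj₁; inj₂)
open import Data.Product using (Σ; ∃; _×_; _,_; proj₁)
open import Data.List using (List; length)
open import Data.List.Membership.Propositional using (_∈_; _∉_)
open import Data.List.Relation.Unary.Unique.Propositional using (Unique)
open import Data.List.Relation.Binary.Subset.Propositional using (_⊆_)
open import Relation.Binary.PropositionalEquality using (_≡_; _≢_)
open import Relation.Nullary using (¬_)
open import Level using (0ℓ)

record SimpleGraph (n : ℕ) : Set where
  field
    adj   : Fin n → Fin n → Bool
    sym   : ∀ i j → adj i j ≡ adj j i
    irrfl : ∀ i → adj i i ≡ false
open SimpleGraph public

-- An edge {i,j} of G, represented canonically with i < j.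
Edge : ∀ {n} → SimpleGraph n → Set
Edge {n} G = Σ (Fin n) λ i → Σ (Fin n) λ j → (i < j) × (adj G i j ≡ true)

_EndOf_ : ∀ {n} {G : SimpleGraph n} → Fin n → Edge G → Set
x EndOf (i , j , _) = (x ≡ i) ⊎ (x ≡ j)

ShareEnd : ∀ {n} {G : SimpleGraph n} → Edge G → Edge G → Set
ShareEnd {n} {G} e f = ∃ λ (x : Fin n) → (_EndOf_ {G = G} x e) × (_EndOf_ {G = G} x f)

-- General graphs (vertex type + adjacency relation), finite subsets as
-- duplicate-free lists; |S| = length S.

record Graph : Set₁ where
  field
    V   : Set
    _~_ : V → V → Set
open Graph public

InClosedNbhd : (H : Graph) → List (V H) → V H → Set
InClosedNbhd H S u = (u ∈ S) ⊎ (∃ λ s → (s ∈ S) × _~_ H s u)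

IsIsolating : (H : Graph) → List (V H) → Set
IsIsolating H S = Unique S ×
  (∀ u v → ¬ InClosedNbhd H S u → ¬ InClosedNbhd H S v → ¬ (_~_ H u v))

IsolationNumber : Graph → ℕ → Set
IsolationNumber H k =
  (∃ λ S → IsIsolating H S × length S ≡ k) ×
  (∀ S → IsIsolating H S → k ≤ length S)

data MidAdj {n} (G : SimpleGraph n) : Fin n ⊎ Edge G → Fin n ⊎ Edge G → Set where
  v-m : ∀ v e → _EndOf_ {G = G} v e → MidAdj G (inj₁ v) (inj₂ e)
  m-v : ∀ e v → _EndOf_ {G = G} v e → MidAdj G (inj₂ e) (inj₁ v)
  m-m : ∀ e f → e ≢ f → ShareEnd {G = G} e f → MidAdj G (inj₂ e) (inj₂ f)

Mid : ∀ {n} → SimpleGraph n → Graph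
Mid {n} G = record { V = Fin n ⊎ Edge G ; _~_ = MidAdj G }

IsMatching : ∀ {n} (G : SimpleGraph n) → List (Edge G) → Set
IsMatching G M = Unique M ×
  (∀ e f → e ∈ M → f ∈ M → e ≢ f → ¬ ShareEnd {G = G} e f)

IsMaximalMatching : ∀ {n} (G : SimpleGraph n) → List (Edge G) → Set
IsMaximalMatching G M = IsMatching G M ×
  (∀ M' → IsMatching G M' → M ⊆ M' → M' ⊆ M)

MinMaximalMatchingSize : ∀ {n} → SimpleGraph n → ℕ → Set
MinMaximalMatchingSize G k =
  (∃ λ M → IsMaximalMatching G M × length M ≡ k) ×
  (∀ M → IsMaximalMatching G M → k ≤ length M)

-- Maximal matchings of G are exactly the matchings M meeting every edge, and then the
-- subdivision vertices of M isolate Mid(G): every subdivision vertex is in N[M], and the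
-- vertices of G form an independent set. Conversely, let S isolate Mid(G). Process S greedily,
-- spending at most one edge per element of S, so that every original vertex in S is covered
-- or has all its neighbours covered, and both endpoints of every edge in S are so. If an edge
-- f = ij met no edge of the resulting matching, then neither m_f nor i would lie in N[S],
-- although they are adjacent in Mid(G). So ι(Mid G) and ν'(G) bound each other.
module Submission where

open import Defs
open import Data.Nat using (ℕ)
open import Data.Product using (∃; _×_)

open import Data.Nat using (suc; _≤_; _<_; s≤s; _≟_)
open import Data.Nat.Properties using (≤-refl; ≤-trans; n≤1+n; ≮⇒≥; anyUpTo?)
open import Data.Nat.Induction using (<-rec)
open import Data.Bool using (true)
import Data.Bool.Properties as Bool
open import Data.Fin using (Fin) renaming (_<_ to _<ᶠ_)
import Data.Fin.Properties as Fin
open import Data.Product using (Σ; _,_; proj₁; proj₂)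
open import Data.Sum using (_⊎_; inj₁; inj₂; [_,_]′)
import Data.Sum as Sum
open import Data.Sum.Properties using (inj₂-injective)
open import Data.List using (List; []; _∷_; [_]; length; map; concatMap; cartesianProductWith; cartesianProduct; allFin)
open import Data.List.Properties using (length-map)
open import Data.List.Relation.Unary.Any as Any using (Any; here; there)
open import Data.List.Relation.Unary.All as All using (All; []; _∷_)
open import Data.List.Relation.Unary.AllPairs using ([]; _∷_)
open import Data.List.Membership.Propositional using (_∈_; _∉_; find; lose)
open import Data.List.Membership.Propositional.Properties
  using (∈-map⁺; ∈-concatMap⁺; ∈-cartesianProductWith⁺; ∈-cartesianProduct⁺; ∈-allFin)
open import Data.List.Relation.Binary.Subset.Propositional using (_⊆_)
open import Data.List.Relation.Binary.Subset.Propositional.Properties using (Any-resp-⊆; ⊆-refl; xs⊆x∷xs)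
import Data.List.Relation.Unary.Unique.Propositional.Properties as Unique
open import Data.Empty using (⊥-elim)
open import Relation.Nullary using (¬_; Dec; yes; no; ¬?)
open import Relation.Nullary.Decidable using (_×-dec_; _⊎-dec_; map′; decidable-stable; toSum)
open import Relation.Unary using (Decidable)
open import Relation.Binary.Definitions using (DecidableEquality; tri<; tri≈; tri>)
import Relation.Binary.PropositionalEquality as ≡
open import Relation.Binary.PropositionalEquality using (_≡_; _≢_; refl; trans; cong; cong₂)
import Axiom.UniquenessOfIdentityProofs as UIP
open import Function using (_∘_)

Minimum : (ℕ → Set) → Set
Minimum P = ∃ λ k → P k × (∀ {j} → P j → k ≤ j)

least-witness : {P : ℕ → Set} → Decidable P → ∀ b → P b → Minimum P
least-witness {P} P? = <-rec (λ b → P b → Minimum P) try-below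
  where
  try-below : ∀ b → (∀ {c} → c < b → P c → Minimum P) → P b → Minimum P
  try-below b below Pb with anyUpTo? P? b
  ... | yes (c , c<b , Pc) = below c<b Pc
  ... | no none            = b , Pb , λ {j} Pj → ≮⇒≥ λ j<b → none (j , j<b , Pj)

listsOver : {A : Set} → List A → ℕ → List (List A)
listsOver xs 0       = [ [] ]
listsOver xs (suc k) = cartesianProductWith _∷_ xs (listsOver xs k)

∈-listsOver : {A : Set} {xs : List A} (ys : List A) → All (_∈ xs) ys → ys ∈ listsOver xs (length ys)
∈-listsOver []       []           = here refl
∈-listsOver (y ∷ ys) (y∈ ∷ ys⊆xs) = ∈-cartesianProductWith⁺ _∷_ y∈ (∈-listsOver ys ys⊆xs)

module _ {n : ℕ} (G : SimpleGraph n) where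

  private
    E : Set
    E = Edge G

    _∈ₑ_ : Fin n → E → Set
    x ∈ₑ e = _EndOf_ {G = G} x e

    Share : E → E → Set
    Share = ShareEnd {G = G}

  edge-≡ : ∀ {i j} {p p′ : i <ᶠ j} {q q′ : adj G i j ≡ true} →
           _≡_ {A = E} (i , j , p , q) (i , j , p′ , q′)
  edge-≡ = cong₂ (λ p q → _ , _ , p , q) (Fin.<-irrelevant _ _) (UIP.Decidable⇒UIP.≡-irrelevant Bool._≟_ _ _)

  _≟ₑ_ : DecidableEquality E
  (i , j , _) ≟ₑ (i′ , j′ , _) with i Fin.≟ i′ | j Fin.≟ j′
  ... | yes refl | yes refl = yes edge-≡
  ... | no i≢i′  | _        = no λ e≡f → i≢i′ (cong proj₁ e≡f)
  ... | yes _    | no j≢j′  = no λ e≡f → j≢j′ (cong (proj₁ ∘ proj₂) e≡f)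

  endOf? : ∀ x e → Dec (x ∈ₑ e)
  endOf? x (i , j , _) = (x Fin.≟ i) ⊎-dec (x Fin.≟ j)

  share-refl : ∀ e → Share e e
  share-refl (i , _) = i , inj₁ refl , inj₁ refl

  share-sym : ∀ e f → Share e f → Share f e
  share-sym _ _ (x , x∈e , x∈f) = x , x∈f , x∈e

  share? : ∀ e f → Dec (Share e f)
  share? (i , j , _) f with endOf? i f | endOf? j f
  ... | yes i∈f | _       = yes (i , inj₁ refl , i∈f)
  ... | no _    | yes j∈f = yes (j , inj₂ refl , j∈f)
  ... | no i∉f  | no j∉f  = no λ { (_ , inj₁ refl , i∈f) → i∉f i∈f ; (_ , inj₂ refl , j∈f) → j∉f j∈f }

  edgeBetween : ∀ v c → adj G v c ≡ true → Σ E λ g → (v ∈ₑ g) × (∀ x → x ∈ₑ g → x ≡ v ⊎ x ≡ c)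
  edgeBetween v c vc with Fin.<-cmp v c
  ... | tri< v<c _ _ = (v , c , v<c , vc) , inj₁ refl , λ _ x∈g → x∈g
  ... | tri> _ _ c<v = (c , v , c<v , trans (sym G c v) vc) , inj₂ refl , λ _ → Sum.swap
  ... | tri≈ _ refl _ with () ← trans (≡.sym vc) (irrfl G v)

  edgesBetween : Fin n × Fin n → List E
  edgesBetween (i , j) with i Fin.<? j | adj G i j Bool.≟ true
  ... | yes i<j | yes ij = [ (i , j , i<j , ij) ]
  ... | _       | _      = []

  ∈-edgesBetween : (e : E) → e ∈ edgesBetween (proj₁ e , proj₁ (proj₂ e))
  ∈-edgesBetween (i , j , i<j , ij) with i Fin.<? j | adj G i j Bool.≟ true
  ... | yes _   | yes _   = here edge-≡
  ... | no i≮j  | _       = ⊥-elim (i≮j i<j)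
  ... | yes _   | no ¬ij  = ⊥-elim (¬ij ij)

  allEdges : List E
  allEdges = concatMap edgesBetween (cartesianProduct (allFin n) (allFin n))

  ∈-allEdges : ∀ e → e ∈ allEdges
  ∈-allEdges e@(i , j , _) =
    ∈-concatMap⁺ edgesBetween (lose (∈-cartesianProduct⁺ (∈-allFin i) (∈-allFin j)) (∈-edgesBetween e))

  Covered : Fin n → List E → Set
  Covered x M = Any (x ∈ₑ_) M

  covered? : ∀ x M → Dec (Covered x M)
  covered? x = Any.any? (endOf? x)

  Meets : E → List E → Set
  Meets f M = Any (Share f) M

  meets? : ∀ f M → Dec (Meets f M)
  meets? f = Any.any? (share? f)

  Dominating : List E → Set
  Dominating M = ∀ f → Meets f M

  matching-∷ : ∀ {g M} → IsMatching G M → (∀ x → x ∈ₑ g → ¬ Covered x M) → IsMatching G (g ∷ M)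
  matching-∷ {g} {M} (unique , disjoint) g-free = (All.tabulate g≢ ∷ unique) , disjoint′
    where
    g∉M : g ∉ M
    g∉M g∈M = let (x , x∈g , _) = share-refl g in g-free x x∈g (lose g∈M x∈g)

    g≢ : ∀ {h} → h ∈ M → g ≢ h
    g≢ h∈M refl = g∉M h∈M

    disjoint′ : ∀ e h → e ∈ g ∷ M → h ∈ g ∷ M → e ≢ h → ¬ Share e h
    disjoint′ _ _ (here refl) (here refl) e≢h _                  = e≢h refl
    disjoint′ _ _ (here refl) (there h∈M) _ (x , x∈g , x∈h)      = g-free x x∈g (lose h∈M x∈h)
    disjoint′ _ _ (there e∈M) (here refl) _ (x , x∈e , x∈g)      = g-free x x∈g (lose e∈M x∈e)
    disjoint′ e h (there e∈M) (there h∈M) e≢h                    = disjoint e h e∈M h∈M e≢h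

  matching∧dominating⇒maximal : ∀ {M} → IsMatching G M → Dominating M → IsMaximalMatching G M
  matching∧dominating⇒maximal {M} matchM dom = matchM , λ _ → M′⊆M
    where
    M′⊆M : ∀ {M′} → IsMatching G M′ → M ⊆ M′ → M′ ⊆ M
    M′⊆M matchM′ M⊆M′ {f} f∈M′ with find (dom f)
    ... | g , g∈M , f~g with f ≟ₑ g
    ...   | yes refl = g∈M
    ...   | no f≢g   = ⊥-elim (proj₂ matchM′ f g f∈M′ (M⊆M′ g∈M) f≢g f~g)

  -- An edge meeting no edge of M can be added to M, so maximality puts it in M itself.
  maximal⇒dominating : ∀ {M} → IsMaximalMatching G M → Dominating M
  maximal⇒dominating {M} (matchM , maximal) f with meets? f M
  ... | yes meets = meets
  ... | no ¬meets = ⊥-elim (¬meets (lose f∈M (share-refl f)))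
    where
    f-free : ∀ x → x ∈ₑ f → ¬ Covered x M
    f-free x x∈f x∈M = let (g , g∈M , x∈g) = find x∈M in ¬meets (lose g∈M (x , x∈f , x∈g))

    f∈M : f ∈ M
    f∈M = maximal (f ∷ M) (matching-∷ matchM f-free) (xs⊆x∷xs M f) (here refl)

  isMatching? : Decidable (IsMatching G)
  isMatching? M = unique? M ×-dec disjoint?
    where
    open import Data.List.Relation.Unary.Unique.DecPropositional _≟ₑ_ using (unique?)

    Disjoint : Set
    Disjoint = ∀ e f → e ∈ M → f ∈ M → e ≢ f → ¬ Share e f

    disjoint? : Dec Disjoint
    disjoint? = map′
      (λ all e f e∈M f∈M e≢f e~f → [ e≢f , (λ ¬e~f → ¬e~f e~f) ]′ (All.lookup (All.lookup all e∈M) f∈M))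
      (λ disjoint → All.tabulate λ {e} e∈M → All.tabulate λ {f} f∈M →
         Sum.map₂ (disjoint e f e∈M f∈M) (toSum (e ≟ₑ f)))
      (All.all? (λ e → All.all? (λ f → (e ≟ₑ f) ⊎-dec ¬? (share? e f)) M) M)

  dominating? : Decidable Dominating
  dominating? M = map′ (λ all f → All.lookup all (∈-allEdges f)) (λ dom → All.tabulate λ {f} _ → dom f)
    (All.all? (λ f → meets? f M) allEdges)

  isMaximalMatching? : Decidable (IsMaximalMatching G)
  isMaximalMatching? M = map′ (λ (matchM , dom) → matching∧dominating⇒maximal matchM dom)
    (λ maxM → proj₁ maxM , maximal⇒dominating maxM) (isMatching? M ×-dec dominating? M)

  HasMaximalMatchingOfSize : ℕ → Set
  HasMaximalMatchingOfSize k = ∃ λ M → IsMaximalMatching G M × length M ≡ k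

  hasMaximalMatchingOfSize? : Decidable HasMaximalMatchingOfSize
  hasMaximalMatchingOfSize? k = map′ fromAny toAny (Any.any? candidate? (listsOver allEdges k))
    where
    Candidate : List E → Set
    Candidate M = IsMaximalMatching G M × length M ≡ k

    candidate? : Decidable Candidate
    candidate? M = isMaximalMatching? M ×-dec (length M ≟ k)

    fromAny : Any Candidate (listsOver allEdges k) → HasMaximalMatchingOfSize k
    fromAny found = let (M , _ , candidate) = find found in M , candidate

    toAny : HasMaximalMatchingOfSize k → Any Candidate (listsOver allEdges k)
    toAny (M , maxM , refl) = lose (∈-listsOver M (All.tabulate λ {e} _ → ∈-allEdges e)) (maxM , refl)

  Settled : Fin n → List E → Set
  Settled x M = Covered x M ⊎ (∀ c → adj G x c ≡ true → Covered c M)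

  Settledᴹ : V (Mid G) → List E → Set
  Settledᴹ (inj₁ x) M = Settled x M
  Settledᴹ (inj₂ e) M = ∀ x → x ∈ₑ e → Settled x M

  settled-⊆ : ∀ {x M M′} → M ⊆ M′ → Settled x M → Settled x M′
  settled-⊆ M⊆M′ = Sum.map (Any-resp-⊆ M⊆M′) λ nbrs c xc → Any-resp-⊆ M⊆M′ (nbrs c xc)

  settledᴹ-⊆ : ∀ s {M M′} → M ⊆ M′ → Settledᴹ s M → Settledᴹ s M′
  settledᴹ-⊆ (inj₁ x) M⊆M′ = settled-⊆ M⊆M′
  settledᴹ-⊆ (inj₂ e) M⊆M′ ends x x∈e = settled-⊆ M⊆M′ (ends x x∈e)

  record Extension (M : List E) (P : List E → Set) : Set where
    constructor extension
    field
      {M′}      : List E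
      matching  : IsMatching G M′
      extends   : M ⊆ M′
      growth    : length M′ ≤ suc (length M)
      satisfies : P M′

  unchanged : ∀ {M P} → IsMatching G M → P M → Extension M P
  unchanged matchM PM = extension matchM ⊆-refl (n≤1+n _) PM

  settle-vertex : ∀ v M → IsMatching G M → Extension M (Settled v)
  settle-vertex v M matchM with covered? v M
  ... | yes v∈M = unchanged matchM (inj₁ v∈M)
  ... | no v∉M with Fin.any? (λ c → (adj G v c Bool.≟ true) ×-dec ¬? (covered? c M))
  ...   | no none = unchanged matchM (inj₂ λ c vc → decidable-stable (covered? c M) λ c∉M → none (c , vc , c∉M))
  ...   | yes (c , vc , c∉M) =
          let (g , v∈g , ends) = edgeBetween v c vc
              g-free x x∈g = [ (λ { refl → v∉M }) , (λ { refl → c∉M }) ]′ (ends x x∈g)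
          in extension (matching-∷ matchM g-free) (xs⊆x∷xs M g) ≤-refl (inj₁ (here v∈g))

  settle : ∀ s M → IsMatching G M → Extension M (Settledᴹ s)
  settle (inj₁ v) M matchM = settle-vertex v M matchM
  settle (inj₂ e@(a , b , _)) M matchM with covered? a M | covered? b M
  ... | yes a∈M | _ =
        let extension matchM′ M⊆M′ growth b-settled = settle-vertex b M matchM
        in extension matchM′ M⊆M′ growth λ { _ (inj₁ refl) → inj₁ (Any-resp-⊆ M⊆M′ a∈M) ; _ (inj₂ refl) → b-settled }
  ... | no _ | yes b∈M =
        let extension matchM′ M⊆M′ growth a-settled = settle-vertex a M matchM
        in extension matchM′ M⊆M′ growth λ { _ (inj₁ refl) → a-settled ; _ (inj₂ refl) → inj₁ (Any-resp-⊆ M⊆M′ b∈M) }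
  ... | no a∉M | no b∉M =
        extension (matching-∷ matchM λ { _ (inj₁ refl) → a∉M ; _ (inj₂ refl) → b∉M }) (xs⊆x∷xs M e) ≤-refl
          λ x x∈e → inj₁ (here x∈e)

  settle-all : ∀ S → ∃ λ M → IsMatching G M × length M ≤ length S × All (λ s → Settledᴹ s M) S
  settle-all []      = [] , ([] , λ _ _ ()) , ≤-refl , []
  settle-all (s ∷ S) =
    let (M , matchM , |M|≤|S| , settledS) = settle-all S
        extension matchM′ M⊆M′ growth s-settled = settle s M matchM
    in _ , matchM′ , ≤-trans growth (s≤s |M|≤|S|) , s-settled ∷ All.map (λ {t} → settledᴹ-⊆ t M⊆M′) settledS

  settled⇒meets : ∀ {x M} f → x ∈ₑ f → Settled x M → Meets f M
  settled⇒meets {x} _ x∈f (inj₁ x∈M) = let (g , g∈M , x∈g) = find x∈M in lose g∈M (x , x∈f , x∈g)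
  settled⇒meets (i , j , _ , ij) (inj₁ refl) (inj₂ nbrs) =
    let (g , g∈M , j∈g) = find (nbrs j ij) in lose g∈M (j , inj₂ refl , j∈g)
  settled⇒meets (i , j , _ , ij) (inj₂ refl) (inj₂ nbrs) =
    let (g , g∈M , i∈g) = find (nbrs i (trans (sym G j i) ij)) in lose g∈M (i , inj₁ refl , i∈g)

  module _ {S M} (settled : All (λ s → Settledᴹ s M) S) where

    vertex-near⇒settled : ∀ {x} → InClosedNbhd (Mid G) S (inj₁ x) → Settled x M
    vertex-near⇒settled (inj₁ x∈S)                      = All.lookup settled x∈S
    vertex-near⇒settled (inj₂ (_ , e∈S , m-v _ _ x∈e)) = All.lookup settled e∈S _ x∈e

    edge-near⇒meets : ∀ {f} → InClosedNbhd (Mid G) S (inj₂ f) → Meets f M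
    edge-near⇒meets {f} (inj₁ f∈S) = settled⇒meets f (inj₁ refl) (All.lookup settled f∈S _ (inj₁ refl))
    edge-near⇒meets (inj₂ (_ , v∈S , v-m _ f v∈f)) = settled⇒meets f v∈f (All.lookup settled v∈S)
    edge-near⇒meets (inj₂ (_ , e∈S , m-m _ f _ (x , x∈e , x∈f))) = settled⇒meets f x∈f (All.lookup settled e∈S x x∈e)

  isolating⇒maximalMatching : ∀ {S} → IsIsolating (Mid G) S → ∃ λ M → IsMaximalMatching G M × length M ≤ length S
  isolating⇒maximalMatching {S} (_ , independent) with settle-all S
  ... | M , matchM , |M|≤|S| , settled = M , matching∧dominating⇒maximal matchM dom , |M|≤|S|
    where
    dom : Dominating M
    dom f@(i , _) = decidable-stable (meets? f M) λ ¬meets →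
      independent (inj₂ f) (inj₁ i) (¬meets ∘ edge-near⇒meets settled)
        (¬meets ∘ settled⇒meets f (inj₁ refl) ∘ vertex-near⇒settled settled) (m-v f i (inj₁ refl))

  maximalMatching⇒isolating : ∀ {M} → IsMaximalMatching G M → IsIsolating (Mid G) (map inj₂ M)
  maximalMatching⇒isolating {M} maxM = Unique.map⁺ inj₂-injective (proj₁ (proj₁ maxM)) , independent
    where
    edge-near : ∀ f → InClosedNbhd (Mid G) (map inj₂ M) (inj₂ f)
    edge-near f with find (maximal⇒dominating maxM f)
    ... | g , g∈M , f~g with f ≟ₑ g
    ...   | yes refl = inj₁ (∈-map⁺ inj₂ g∈M)
    ...   | no f≢g   = inj₂ (inj₂ g , ∈-map⁺ inj₂ g∈M , m-m g f (f≢g ∘ ≡.sym) (share-sym f g f~g))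

    independent : ∀ u v → ¬ InClosedNbhd (Mid G) (map inj₂ M) u → ¬ InClosedNbhd (Mid G) (map inj₂ M) v →
                  ¬ MidAdj G u v
    independent (inj₂ f) _        u-far _     _  = u-far (edge-near f)
    independent (inj₁ _) (inj₂ f) _     v-far _  = v-far (edge-near f)
    independent (inj₁ _) (inj₁ _) _     _     ()

  maximalMatching-exists : ∃ (IsMaximalMatching G)
  maximalMatching-exists with settle-all (map inj₁ (allFin n))
  ... | M , matchM , _ , settled = M , matching∧dominating⇒maximal matchM dom
    where
    dom : Dominating M
    dom f@(i , _) = settled⇒meets f (inj₁ refl) (All.lookup settled (∈-map⁺ inj₁ (∈-allFin i)))

theorem1 : ∀ (n : ℕ) (G : SimpleGraph n) → ∃ λ (k : ℕ) → IsolationNumber (Mid G) k × MinMaximalMatchingSize G k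
theorem1 n G =
  let (M₀ , maxM₀) = maximalMatching-exists G
      (k , (M , maxM , |M|≡k) , minimal) = least-witness (hasMaximalMatchingOfSize? G) _ (M₀ , maxM₀ , refl)
      lower : ∀ {M′} → IsMaximalMatching G M′ → k ≤ length M′
      lower maxM′ = minimal (_ , maxM′ , refl)
  in k
   , ( (map inj₂ M , maximalMatching⇒isolating G maxM , trans (length-map inj₂ M) |M|≡k)
     , λ S isoS → let (M′ , maxM′ , |M′|≤|S|) = isolating⇒maximalMatching G isoS in ≤-trans (lower maxM′) |M′|≤|S|)
   , ((M , maxM , |M|≡k) , λ _ → lower)
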